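{- Let $q\in\mathbb{C}$ and let $n$ be any positive integer. Then $$\det[q^{|j-k|}+\delta_{jk}]_{1\le j,k\le n}=u_{n+1}(2,q^2)$$ and $$\det[q^{|j-k|}-\delta_{jk}]_{1\le j,k\le n}=(-1)^{n-1}q^n\,u_{n-1}(2q,1),$$ where $\delta_{jk}$ is $1$ if $j=k$ and $0$ otherwise.
   Context: For $a,b\in\mathbb{C}$, the Lucas sequence $(u_n(a,b))_{n\ge0}$ is defined by $u_0(a,b)=0$, $u_1(a,b)=1$, and $u_{n+1}(a,b)=au_n(a,b)-bu_{n-1}(a,b)$ for $n\ge1$. The convention $0^0=1$ is used. -}

module Defs where

open import Level using (Level)
open import Algebra.Bundles using (CommutativeRing)
open import Data.Nat using (ℕ; zero; suc)
open import Data.Fin using (Fin; zero; suc; punchIn; toℕ; _≟_)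
open import Relation.Nullary using (yes; no)

module _ {c ℓ : Level} (R : CommutativeRing c ℓ) where
  open CommutativeRing R using (Carrier; _+_; _*_; -_; _-_; 0#; 1#)

  -- q ^ m with the convention q ^ 0 = 1 (so 0^0 = 1)
  pow : Carrier → ℕ → Carrier
  pow q zero    = 1#
  pow q (suc m) = q * pow q m

  δ : ∀ {n} → Fin n → Fin n → Carrier
  δ j k with j ≟ k
  ... | yes _ = 1#
  ... | no  _ = 0#

  sumFin : ∀ n → (Fin n → Carrier) → Carrier
  sumFin zero    f = 0#
  sumFin (suc n) f = f zero + sumFin n (λ i → f (suc i))

  det : ∀ n → (Fin n → Fin n → Carrier) → Carrier
  det zero    M = 1#
  det (suc n) M =
    sumFin (suc n) (λ j → pow (- 1#) (toℕ j) * (M zero j * det n (λ i k → M (suc i) (punchIn j k))))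

  lucas : Carrier → Carrier → ℕ → Carrier
  lucas a b zero          = 0#
  lucas a b (suc zero)    = 1#
  lucas a b (suc (suc m)) = a * lucas a b (suc m) - b * lucas a b m

-- Write D n c for the determinant of the n × n matrix q^|j-k| + c δ.  Subtracting q times column 1
-- from column 0 leaves (1 + c - q², -qc, 0, …, 0) as column 0, and in the minor belonging to the
-- entry -qc the first row is q times the first row of the (n+1)-matrix minus qc e₀.  Hence
--   D (n+2) c = ((1 + c) - q²(1 - c)) D (n+1) c - q²c² D n c.
-- For c = 1 this is the Lucas recurrence of u(2, q²), shifted by one; for c = -1 it is also satisfied
-- by (-1)^n q^(n+1) u_n(2q, 1).  Comparing two initial values proves both identities.  Because det is
-- defined by expansion along row 0, the column facts used (linearity in column 0, vanishing when
-- columns 0 and 1 agree, expansion along a column 0 with at most two nonzero entries) go by induction.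
module Submission where

open import Defs
open import Level using (Level)
open import Algebra.Bundles using (CommutativeRing)
open import Algebra.Solver.Ring.AlmostCommutativeRing
  using (fromCommutativeRing; _-Raw-AlmostCommutative⟶_)
open import Data.Nat as ℕ using (ℕ; zero; suc; _≤_; _∸_; ∣_-_∣)
import Data.Nat.Properties as ℕ
open import Data.Integer as ℤ using (ℤ; +_; -[1+_]; _◃_; _⊖_)
import Data.Integer.Properties as ℤ
open import Data.Sign as Sign using (Sign)
open import Data.Fin using (Fin; zero; suc; punchIn; toℕ; _≟_)
open import Data.Vec.Functional using (Vector; _∷_; head; tail)
open import Data.Product using (_×_; _,_; proj₁)
import Data.Maybe as Maybe
open import Relation.Nullary using (yes; no)
open import Relation.Nullary.Decidable using (dec⇒maybe)
open import Relation.Binary.PropositionalEquality as ≡ using (_≡_; cong)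

-- The library's ring solvers either lack negation (natural coefficients) or need a zero test on the
-- carrier; integer coefficients, mapped in by ℤ-cast, give a solver for every commutative ring.
module IntegerCoefficientSolver {c ℓ : Level} (R : CommutativeRing c ℓ) where
  open CommutativeRing R hiding (zero)
  open import Algebra.Properties.Ring ring using (-‿involutive; -0#≈0#; -1*x≈-x; -‿+-comm)
  open import Algebra.Properties.Semiring.Mult.TCOptimised semiring
    using (×-homo-+; ×1-homo-*; 1+×) renaming (_×_ to _·_)
  open import Algebra.Properties.CommutativeSemigroup *-commutativeSemigroup
    using (interchange)
  open import Algebra.Properties.CommutativeSemigroup +-commutativeSemigroup
    using () renaming (interchange to +-interchange)
  open import Relation.Binary.Reasoning.Setoid setoid

  -- The TC-optimised multiple makes ℤ-cast (+ 1) and ℤ-cast (+ 2) definitionally 1# and 1# + 1#.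
  ℤ-cast : ℤ → Carrier
  ℤ-cast (+ n)    = n · 1#
  ℤ-cast -[1+ n ] = - (suc n · 1#)

  sign-cast : Sign → Carrier
  sign-cast Sign.+ = 1#
  sign-cast Sign.- = - 1#

  sign-cast-* : ∀ s t → sign-cast (s Sign.* t) ≈ sign-cast s * sign-cast t
  sign-cast-* Sign.+ t      = sym (*-identityˡ _)
  sign-cast-* Sign.- Sign.+ = sym (*-identityʳ _)
  sign-cast-* Sign.- Sign.- = sym (trans (-1*x≈-x (- 1#)) (-‿involutive 1#))

  ℤ-cast-◃ : ∀ s n → ℤ-cast (s ◃ n) ≈ sign-cast s * (n · 1#)
  ℤ-cast-◃ s      zero    = sym (zeroʳ _)
  ℤ-cast-◃ Sign.+ (suc n) = sym (*-identityˡ _)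
  ℤ-cast-◃ Sign.- (suc n) = sym (-1*x≈-x _)

  ℤ-cast-sign-abs : ∀ i → ℤ-cast i ≈ sign-cast (ℤ.sign i) * (ℤ.∣ i ∣ · 1#)
  ℤ-cast-sign-abs i = begin
    ℤ-cast i                               ≡⟨ cong ℤ-cast (ℤ.◃-inverse i) ⟨
    ℤ-cast (ℤ.sign i ◃ ℤ.∣ i ∣)            ≈⟨ ℤ-cast-◃ (ℤ.sign i) ℤ.∣ i ∣ ⟩
    sign-cast (ℤ.sign i) * (ℤ.∣ i ∣ · 1#)  ∎

  ℤ-cast-* : ∀ i j → ℤ-cast (i ℤ.* j) ≈ ℤ-cast i * ℤ-cast j
  ℤ-cast-* i j = begin
    ℤ-cast (ℤ.sign i Sign.* ℤ.sign j ◃ ℤ.∣ i ∣ ℕ.* ℤ.∣ j ∣)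
      ≈⟨ ℤ-cast-◃ (ℤ.sign i Sign.* ℤ.sign j) (ℤ.∣ i ∣ ℕ.* ℤ.∣ j ∣) ⟩
    sign-cast (ℤ.sign i Sign.* ℤ.sign j) * ((ℤ.∣ i ∣ ℕ.* ℤ.∣ j ∣) · 1#)
      ≈⟨ *-cong (sign-cast-* (ℤ.sign i) (ℤ.sign j)) (×1-homo-* ℤ.∣ i ∣ ℤ.∣ j ∣) ⟩
    (sign-cast (ℤ.sign i) * sign-cast (ℤ.sign j)) * ((ℤ.∣ i ∣ · 1#) * (ℤ.∣ j ∣ · 1#))
      ≈⟨ interchange _ _ _ _ ⟩
    (sign-cast (ℤ.sign i) * (ℤ.∣ i ∣ · 1#)) * (sign-cast (ℤ.sign j) * (ℤ.∣ j ∣ · 1#))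
      ≈⟨ *-cong (ℤ-cast-sign-abs i) (ℤ-cast-sign-abs j) ⟨
    ℤ-cast i * ℤ-cast j ∎

  ℤ-cast-⊖ : ∀ m n → ℤ-cast (m ⊖ n) ≈ m · 1# - n · 1#
  ℤ-cast-⊖ m       zero    = sym (trans (+-congˡ -0#≈0#) (+-identityʳ _))
  ℤ-cast-⊖ zero    (suc n) = sym (+-identityˡ _)
  ℤ-cast-⊖ (suc m) (suc n) = begin
    ℤ-cast (suc m ⊖ suc n)         ≡⟨ cong ℤ-cast (ℤ.[1+m]⊖[1+n]≡m⊖n m n) ⟩
    ℤ-cast (m ⊖ n)                 ≈⟨ ℤ-cast-⊖ m n ⟩
    m · 1# - n · 1#                ≈⟨ +-identityˡ _ ⟨
    0# + (m · 1# - n · 1#)         ≈⟨ +-congʳ (-‿inverseʳ 1#) ⟨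
    (1# - 1#) + (m · 1# - n · 1#)  ≈⟨ +-interchange 1# (- 1#) (m · 1#) (- (n · 1#)) ⟩
    (1# + m · 1#) + (- 1# - n · 1#) ≈⟨ +-congˡ (-‿+-comm 1# (n · 1#)) ⟩
    (1# + m · 1#) - (1# + n · 1#)  ≈⟨ +-cong (1+× m 1#) (-‿cong (1+× n 1#)) ⟨
    suc m · 1# - suc n · 1#        ∎

  ℤ-cast-+ : ∀ i j → ℤ-cast (i ℤ.+ j) ≈ ℤ-cast i + ℤ-cast j
  ℤ-cast-+ (+ m)    (+ n)    = ×-homo-+ 1# m n
  ℤ-cast-+ (+ m)    -[1+ n ] = ℤ-cast-⊖ m (suc n)
  ℤ-cast-+ -[1+ m ] (+ n)    = trans (ℤ-cast-⊖ n (suc m)) (+-comm _ _)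
  ℤ-cast-+ -[1+ m ] -[1+ n ] = begin
    - (suc (suc (m ℕ.+ n)) · 1#)  ≡⟨ cong (λ k → - (suc k · 1#)) (ℕ.+-suc m n) ⟨
    - ((suc m ℕ.+ suc n) · 1#)    ≈⟨ -‿cong (×-homo-+ 1# (suc m) (suc n)) ⟩
    - (suc m · 1# + suc n · 1#)   ≈⟨ -‿+-comm _ _ ⟨
    - (suc m · 1#) - suc n · 1#   ∎

  ℤ-cast-- : ∀ i → ℤ-cast (ℤ.- i) ≈ - ℤ-cast i
  ℤ-cast-- -[1+ n ]    = sym (-‿involutive _)
  ℤ-cast-- (+ zero)    = sym -0#≈0#
  ℤ-cast-- (+ (suc n)) = refl

  ℤ-cast-homomorphism : ℤ.+-*-rawRing -Raw-AlmostCommutative⟶ fromCommutativeRing R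
  ℤ-cast-homomorphism = record
    { ⟦_⟧    = ℤ-cast
    ; +-homo = ℤ-cast-+
    ; *-homo = ℤ-cast-*
    ; -‿homo = ℤ-cast--
    ; 0-homo = refl
    ; 1-homo = refl
    }

  open import Algebra.Solver.Ring ℤ.+-*-rawRing (fromCommutativeRing R) ℤ-cast-homomorphism
    (λ i j → Maybe.map (λ i≡j → reflexive (cong ℤ-cast i≡j)) (dec⇒maybe (i ℤ.≟ j)))
    public

module _ {c ℓ : Level} (R : CommutativeRing c ℓ) where
  open CommutativeRing R hiding (zero)
  open IntegerCoefficientSolver R using (Polynomial; solve; _:=_; _:+_; _:*_; _:-_; :-_; con)
  open import Relation.Binary.Reasoning.Setoid setoid

  :0 :1 :2 : ∀ {n} → Polynomial n
  :0 = con (+ 0)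
  :1 = con (+ 1)
  :2 = con (+ 2)

  Matrix : ℕ → ℕ → Set c
  Matrix m n = Fin m → Fin n → Carrier

  sumFin-cong : ∀ n {f g : Vector Carrier n} → (∀ i → f i ≈ g i) → sumFin R n f ≈ sumFin R n g
  sumFin-cong zero    f≈g = refl
  sumFin-cong (suc n) f≈g = +-cong (f≈g zero) (sumFin-cong n (λ i → f≈g (suc i)))

  sumFin-zero : ∀ n {f : Vector Carrier n} → (∀ i → f i ≈ 0#) → sumFin R n f ≈ 0#
  sumFin-zero zero    f≈0 = refl
  sumFin-zero (suc n) f≈0 =
    trans (+-cong (f≈0 zero) (sumFin-zero n (λ i → f≈0 (suc i)))) (+-identityʳ 0#)

  sumFin-distrib-+ : ∀ n (f g : Vector Carrier n) →
    sumFin R n (λ i → f i + g i) ≈ sumFin R n f + sumFin R n g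
  sumFin-distrib-+ zero    f g = sym (+-identityʳ 0#)
  sumFin-distrib-+ (suc n) f g =
    trans (+-congˡ (sumFin-distrib-+ n (λ i → f (suc i)) (λ i → g (suc i))))
          (solve 4 (λ a b A B → (a :+ b) :+ (A :+ B) := (a :+ A) :+ (b :+ B)) refl _ _ _ _)

  sumFin-distribˡ-* : ∀ n x (f : Vector Carrier n) → sumFin R n (λ i → x * f i) ≈ x * sumFin R n f
  sumFin-distribˡ-* zero    x f = sym (zeroʳ x)
  sumFin-distribˡ-* (suc n) x f =
    trans (+-congˡ (sumFin-distribˡ-* n x (λ i → f (suc i)))) (sym (distribˡ x _ _))

  sumFin-linear : ∀ n x y (f g : Vector Carrier n) →
    sumFin R n (λ i → x * f i + y * g i) ≈ x * sumFin R n f + y * sumFin R n g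
  sumFin-linear n x y f g = trans (sumFin-distrib-+ n (λ i → x * f i) (λ i → y * g i))
    (+-cong (sumFin-distribˡ-* n x f) (sumFin-distribˡ-* n y g))

  minor : ∀ {n} → Matrix (suc n) (suc n) → Fin (suc n) → Matrix n n
  minor M j i k = M (suc i) (punchIn j k)

  expansionTerm : ∀ {n} → Matrix (suc n) (suc n) → Vector Carrier (suc n)
  expansionTerm {n} M j = pow R (- 1#) (toℕ j) * (M zero j * det R n (minor M j))

  expansionTerm-zero : ∀ {n} (M : Matrix (suc n) (suc n)) j → det R n (minor M j) ≈ 0# →
    expansionTerm M j ≈ 0#
  expansionTerm-zero M j d≈0 =
    trans (*-congˡ (*-congˡ d≈0)) (solve 2 (λ s e → s :* (e :* :0) := :0) refl _ _)

  det-cong : ∀ n {M N : Matrix n n} → (∀ i k → M i k ≈ N i k) → det R n M ≈ det R n N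
  det-cong zero    M≈N = refl
  det-cong (suc n) {M} {N} M≈N = sumFin-cong (suc n) {expansionTerm M} {expansionTerm N} λ j →
    *-congˡ (*-cong (M≈N zero j) (det-cong n (λ i k → M≈N (suc i) (punchIn j k))))

  det-linear-row₀ : ∀ n x y (u v : Vector Carrier (suc n)) (L : Matrix n (suc n)) →
    det R (suc n) ((λ k → x * u k + y * v k) ∷ L) ≈
      x * det R (suc n) (u ∷ L) + y * det R (suc n) (v ∷ L)
  det-linear-row₀ n x y u v L = trans
    (sumFin-cong (suc n) λ j →
      solve 6 (λ s x y a b d → s :* ((x :* a :+ y :* b) :* d)
                                 := x :* (s :* (a :* d)) :+ y :* (s :* (b :* d)))
            refl (pow R (- 1#) (toℕ j)) x y (u j) (v j) (det R n (minor (u ∷ L) j)))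
    (sumFin-linear (suc n) x y (expansionTerm (u ∷ L)) (expansionTerm (v ∷ L)))

  det-row₀-unit : ∀ n (L : Matrix n (suc n)) →
    det R (suc n) ((1# ∷ λ _ → 0#) ∷ L) ≈ det R n (λ i k → L i (suc k))
  det-row₀-unit n L = trans
    (+-cong (*-identityˡ _) (sumFin-zero n {λ j → expansionTerm ((1# ∷ λ _ → 0#) ∷ L) (suc j)}
      λ j → trans (*-congˡ (zeroˡ _)) (zeroʳ _)))
    (trans (+-identityʳ _) (*-identityˡ _))

  det-minor-suc : ∀ n (w : Vector Carrier (suc (suc n))) (C : Matrix (suc (suc n)) (suc n)) j →
    det R (suc n) (minor (λ i → w i ∷ C i) (suc j)) ≈
      det R (suc n) (λ i → w (suc i) ∷ λ k → C (suc i) (punchIn j k))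
  det-minor-suc n w C j =
    det-cong (suc n) {minor (λ i → w i ∷ C i) (suc j)}
                     {λ i → w (suc i) ∷ λ k → C (suc i) (punchIn j k)}
    λ { i zero → refl ; i (suc k) → refl }

  det-linear-col₀ : ∀ n x y (u v : Vector Carrier (suc n)) (C : Matrix (suc n) n) →
    det R (suc n) (λ i → (x * u i + y * v i) ∷ C i) ≈
      x * det R (suc n) (λ i → u i ∷ C i) + y * det R (suc n) (λ i → v i ∷ C i)
  det-linear-col₀ n x y u v C = trans
    (sumFin-cong (suc n) (term-linear n u v C))
    (sumFin-linear (suc n) x y (expansionTerm (λ i → u i ∷ C i)) (expansionTerm (λ i → v i ∷ C i)))
    where
    term-linear : ∀ n (u v : Vector Carrier (suc n)) (C : Matrix (suc n) n) j →
      expansionTerm (λ i → (x * u i + y * v i) ∷ C i) j ≈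
        x * expansionTerm (λ i → u i ∷ C i) j + y * expansionTerm (λ i → v i ∷ C i) j
    term-linear n u v C zero =
      solve 5 (λ x y a b d → :1 :* ((x :* a :+ y :* b) :* d)
                 := x :* (:1 :* (a :* d)) :+ y :* (:1 :* (b :* d))) refl x y _ _ _
    term-linear (suc n) u v C (suc j) = trans (*-congˡ (*-congˡ minor-linear))
      (solve 6 (λ s e x y a b → s :* (e :* (x :* a :+ y :* b))
                                 := x :* (s :* (e :* a)) :+ y :* (s :* (e :* b)))
             refl _ _ x y _ _)
      where
      C′ : Matrix (suc n) n
      C′ i k = C (suc i) (punchIn j k)
      minor-linear : det R (suc n) (minor (λ i → (x * u i + y * v i) ∷ C i) (suc j)) ≈
        x * det R (suc n) (minor (λ i → u i ∷ C i) (suc j)) +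
        y * det R (suc n) (minor (λ i → v i ∷ C i) (suc j))
      minor-linear = trans (det-minor-suc n (λ i → x * u i + y * v i) C j)
        (trans (det-linear-col₀ n x y (tail u) (tail v) C′)
               (sym (+-cong (*-congˡ (det-minor-suc n u C j)) (*-congˡ (det-minor-suc n v C j)))))

  det-col₀-zero : ∀ n (w : Vector Carrier (suc n)) (C : Matrix (suc n) n) →
    (∀ i → w i ≈ 0#) → det R (suc n) (λ i → w i ∷ C i) ≈ 0#
  det-col₀-zero n w C w≈0 = begin
    det R (suc n) (λ i → w i ∷ C i)
      ≈⟨ det-cong (suc n) {λ i → w i ∷ C i} {λ i → (0# * w i + 0# * w i) ∷ C i}
           (λ { i zero → trans (w≈0 i) (solve 1 (λ a → :0 := :0 :* a :+ :0 :* a) refl (w i))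
              ; i (suc k) → refl }) ⟩
    det R (suc n) (λ i → (0# * w i + 0# * w i) ∷ C i)
      ≈⟨ det-linear-col₀ n 0# 0# w w C ⟩
    0# * D + 0# * D
      ≈⟨ solve 1 (λ d → :0 :* d :+ :0 :* d := :0) refl D ⟩
    0# ∎
    where
    D = det R (suc n) (λ i → w i ∷ C i)

  det-repeated-col₀ : ∀ n (w : Vector Carrier (suc (suc n))) (C : Matrix (suc (suc n)) n) →
    det R (suc (suc n)) (λ i → w i ∷ w i ∷ C i) ≈ 0#
  det-repeated-col₀ n w C = begin
    t₀ + (t₁ + sumFin R n (λ j → expansionTerm M (suc (suc j))))
      ≈⟨ +-cong (*-congˡ (*-congˡ minor₀≈minor₁)) (+-congˡ (sumFin-zero n (later-terms n w C))) ⟩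
    1# * (w zero * D₁) + ((- 1# * 1#) * (w zero * D₁) + 0#)
      ≈⟨ solve 2 (λ a d → :1 :* (a :* d) :+ ((:- :1 :* :1) :* (a :* d) :+ :0)
                            := :0) refl (w zero) D₁ ⟩
    0# ∎
    where
    M : Matrix (suc (suc n)) (suc (suc n))
    M i = w i ∷ w i ∷ C i
    t₀ = expansionTerm M zero
    t₁ = expansionTerm M (suc zero)
    D₁ = det R (suc n) (minor M (suc zero))
    minor₀≈minor₁ : det R (suc n) (minor M zero) ≈ D₁
    minor₀≈minor₁ = det-cong (suc n) {minor M zero} {minor M (suc zero)}
      λ { i zero → refl ; i (suc k) → refl }
    later-terms : ∀ n (w : Vector Carrier (suc (suc n))) (C : Matrix (suc (suc n)) n) j →
      expansionTerm (λ i → w i ∷ w i ∷ C i) (suc (suc j)) ≈ 0#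
    later-terms (suc n) w C j = expansionTerm-zero (λ i → w i ∷ w i ∷ C i) (suc (suc j)) (trans
      (det-cong (suc (suc n)) {minor (λ i → w i ∷ w i ∷ C i) (suc (suc j))}
                              {λ i → w (suc i) ∷ w (suc i) ∷ λ k → C (suc i) (punchIn j k)}
                              λ { i zero → refl ; i (suc zero) → refl ; i (suc (suc k)) → refl })
      (det-repeated-col₀ n (tail w) (λ i k → C (suc i) (punchIn j k))))

  det-col₀-add-col₁ : ∀ n x (u v : Vector Carrier (suc (suc n))) (C : Matrix (suc (suc n)) n) →
    det R (suc (suc n)) (λ i → (u i + x * v i) ∷ v i ∷ C i) ≈
      det R (suc (suc n)) (λ i → u i ∷ v i ∷ C i)
  det-col₀-add-col₁ n x u v C = begin
    det R (suc (suc n)) (λ i → (u i + x * v i) ∷ v i ∷ C i)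
      ≈⟨ det-cong (suc (suc n)) {λ i → (u i + x * v i) ∷ v i ∷ C i}
                                {λ i → (1# * u i + x * v i) ∷ v i ∷ C i}
           (λ { i zero → +-congʳ (sym (*-identityˡ (u i))) ; i (suc k) → refl }) ⟩
    det R (suc (suc n)) (λ i → (1# * u i + x * v i) ∷ v i ∷ C i)
      ≈⟨ det-linear-col₀ (suc n) 1# x u v (λ i → v i ∷ C i) ⟩
    1# * D + x * det R (suc (suc n)) (λ i → v i ∷ v i ∷ C i)
      ≈⟨ +-congˡ (*-congˡ (det-repeated-col₀ n v C)) ⟩
    1# * D + x * 0#
      ≈⟨ solve 2 (λ d x → :1 :* d :+ x :* :0 := d) refl D x ⟩
    D ∎
    where
    D = det R (suc (suc n)) (λ i → u i ∷ v i ∷ C i)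

  det-col₀-single : ∀ n (w : Vector Carrier (suc n)) (C : Matrix (suc n) n) →
    (∀ i → w (suc i) ≈ 0#) → det R (suc n) (λ i → w i ∷ C i) ≈ w zero * det R n (tail C)
  det-col₀-single n w C w≈0 =
    trans (+-cong (*-identityˡ _) (sumFin-zero n (later-terms n w C w≈0))) (+-identityʳ _)
    where
    later-terms : ∀ n (w : Vector Carrier (suc n)) (C : Matrix (suc n) n) →
      (∀ i → w (suc i) ≈ 0#) → ∀ j → expansionTerm (λ i → w i ∷ C i) (suc j) ≈ 0#
    later-terms (suc n) w C w≈0 j = expansionTerm-zero (λ i → w i ∷ C i) (suc j)
      (trans (det-minor-suc n w C j) (det-col₀-zero n (tail w) (λ i k → C (suc i) (punchIn j k)) w≈0))

  det-col₀-pair : ∀ n (w : Vector Carrier (suc (suc n))) (C : Matrix (suc (suc n)) (suc n)) →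
    (∀ i → w (suc (suc i)) ≈ 0#) →
    det R (suc (suc n)) (λ i → w i ∷ C i) ≈
      w zero * det R (suc n) (tail C) - w (suc zero) * det R (suc n) (head C ∷ tail (tail C))
  det-col₀-pair n w C w≈0 = begin
    1# * (w zero * det R (suc n) (tail C)) + sumFin R (suc n) (λ j → expansionTerm M (suc j))
      ≈⟨ +-congˡ (sumFin-cong (suc n) later-terms) ⟩
    1# * (w zero * det R (suc n) (tail C)) + sumFin R (suc n) (λ j → - w (suc zero) * expansionTerm Q j)
      ≈⟨ +-congˡ (sumFin-distribˡ-* (suc n) (- w (suc zero)) (expansionTerm Q)) ⟩
    1# * (w zero * det R (suc n) (tail C)) + - w (suc zero) * det R (suc n) Q
      ≈⟨ solve 4 (λ a d b e → :1 :* (a :* d) :+ (:- b) :* e := a :* d :- b :* e) refl _ _ _ _ ⟩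
    w zero * det R (suc n) (tail C) - w (suc zero) * det R (suc n) Q ∎
    where
    M : Matrix (suc (suc n)) (suc (suc n))
    M i = w i ∷ C i
    Q : Matrix (suc n) (suc n)
    Q = head C ∷ tail (tail C)
    later-terms : ∀ j → expansionTerm M (suc j) ≈ - w (suc zero) * expansionTerm Q j
    later-terms j = trans
      (*-congˡ (*-congˡ (trans (det-minor-suc n w C j)
        (det-col₀-single n (tail w) (λ i k → C (suc i) (punchIn j k)) w≈0))))
      (solve 4 (λ s e b d → (:- :1 :* s) :* (e :* (b :* d)) := (:- b) :* (s :* (e :* d))) refl _ _ _ _)

  Recurrent : Carrier → Carrier → (ℕ → Carrier) → Set ℓ
  Recurrent a b f = ∀ m → f (suc (suc m)) ≈ a * f (suc m) - b * f m

  recurrent-unique : ∀ {a b f g} → Recurrent a b f → Recurrent a b g →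
    f 0 ≈ g 0 → f 1 ≈ g 1 → ∀ m → f m ≈ g m
  recurrent-unique {f = f} {g} f-rec g-rec f₀≈g₀ f₁≈g₁ m = proj₁ (consecutive m)
    where
    consecutive : ∀ m → f m ≈ g m × f (suc m) ≈ g (suc m)
    consecutive zero    = f₀≈g₀ , f₁≈g₁
    consecutive (suc m) with consecutive m
    ... | here , next =
      next , trans (f-rec m) (trans (+-cong (*-congˡ next) (-‿cong (*-congˡ here))) (sym (g-rec m)))

  δ-suc : ∀ {n} (j k : Fin n) → δ R (suc j) (suc k) ≡ δ R j k
  δ-suc j k with j ≟ k
  ... | yes _ = ≡.refl
  ... | no _  = ≡.refl

  kms : Carrier → Carrier → ∀ n → Matrix n n
  kms q c n j k = pow R q ∣ toℕ j - toℕ k ∣ + c * δ R j k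

  kms-suc : ∀ q c n (i k : Fin n) → kms q c (suc n) (suc i) (suc k) ≈ kms q c n i k
  kms-suc q c n i k = +-congˡ (*-congˡ (reflexive (δ-suc i k)))

  det-kms-recurrence : ∀ q c m →
    det R (suc (suc m)) (kms q c (suc (suc m))) ≈
      ((1# + c) - q * q * (1# - c)) * det R (suc m) (kms q c (suc m)) -
      (q * c) * (q * c) * det R m (kms q c m)
  det-kms-recurrence q c m = begin
    det R (suc (suc m)) M
      ≈⟨ det-cong (suc (suc m)) {M} {λ i → w₀ i ∷ w₁ i ∷ C i}
           (λ { i zero → refl ; i (suc zero) → refl ; i (suc (suc k)) → refl }) ⟩
    det R (suc (suc m)) (λ i → w₀ i ∷ w₁ i ∷ C i)
      ≈⟨ det-col₀-add-col₁ m (- q) w₀ w₁ C ⟨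
    det R (suc (suc m)) (λ i → w i ∷ w₁ i ∷ C i)
      ≈⟨ det-col₀-pair m w (λ i → w₁ i ∷ C i) w-vanishes ⟩
    w zero * det R (suc m) (λ i → w₁ (suc i) ∷ C (suc i)) - w (suc zero) * det R (suc m) Q
      ≈⟨ +-cong (*-congˡ lower-right) (-‿cong (*-congˡ det-Q)) ⟩
    w zero * D₁ - w (suc zero) * (q * D₁ + - (q * c) * D₀)
      ≈⟨ solve 4 (λ q c X Y →
           ((:1 :+ c :* :1) :+ (:- q) :* (q :* :1 :+ c :* :0)) :* X
             :- ((q :* :1 :+ c :* :0) :+ (:- q) :* (:1 :+ c :* :1))
                :* (q :* X :+ (:- (q :* c)) :* Y)
           := ((:1 :+ c) :- q :* q :* (:1 :- c)) :* X :- (q :* c) :* (q :* c) :* Y)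
           refl q c D₁ D₀ ⟩
    ((1# + c) - q * q * (1# - c)) * D₁ - (q * c) * (q * c) * D₀ ∎
    where
    M = kms q c (suc (suc m))
    D₁ = det R (suc m) (kms q c (suc m))
    D₀ = det R m (kms q c m)
    w₀ w₁ w : Vector Carrier (suc (suc m))
    w₀ i = M i zero
    w₁ i = M i (suc zero)
    w i = w₀ i + - q * w₁ i
    C : Matrix (suc (suc m)) m
    C i k = M i (suc (suc k))
    Q : Matrix (suc m) (suc m)
    Q = (w₁ zero ∷ C zero) ∷ λ i → w₁ (suc (suc i)) ∷ C (suc (suc i))
    w-vanishes : ∀ i → w (suc (suc i)) ≈ 0#
    w-vanishes i = solve 3 (λ q p c → (q :* (q :* p) :+ c :* :0) :+ (:- q) :* (q :* p :+ c :* :0)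
                                     := :0) refl q (pow R q (toℕ i)) c
    lower-right : det R (suc m) (λ i → w₁ (suc i) ∷ C (suc i)) ≈ D₁
    lower-right = det-cong (suc m) {λ i → w₁ (suc i) ∷ C (suc i)} {kms q c (suc m)}
      (λ { i zero → kms-suc q c (suc m) i zero ; i (suc k) → kms-suc q c (suc m) i (suc k) })
    det-Q : det R (suc m) Q ≈ q * D₁ + - (q * c) * D₀
    det-Q = begin
      det R (suc m) Q
        ≈⟨ det-cong (suc m) {Q} {(λ k → q * kms q c (suc m) zero k + - (q * c) * e k) ∷ L} (λ
             { zero zero → solve 2 (λ q c → q :* :1 :+ c :* :0
                 := q :* (:1 :+ c :* :1) :+ (:- (q :* c)) :* :1) refl q c
             ; zero (suc k) → solve 3 (λ q p c → q :* (q :* p) :+ c :* :0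
                 := q :* (q :* p :+ c :* :0) :+ (:- (q :* c)) :* :0) refl q (pow R q (toℕ k)) c
             ; (suc i) k → refl }) ⟩
      det R (suc m) ((λ k → q * kms q c (suc m) zero k + - (q * c) * e k) ∷ L)
        ≈⟨ det-linear-row₀ m q (- (q * c)) (kms q c (suc m) zero) e L ⟩
      q * det R (suc m) (kms q c (suc m) zero ∷ L) + - (q * c) * det R (suc m) (e ∷ L)
        ≈⟨ +-cong (*-congˡ upper) (*-congˡ lower) ⟩
      q * D₁ + - (q * c) * D₀ ∎
      where
      e : Vector Carrier (suc m)
      e = 1# ∷ λ _ → 0#
      L : Matrix m (suc m)
      L i = Q (suc i)
      upper : det R (suc m) (kms q c (suc m) zero ∷ L) ≈ D₁
      upper = det-cong (suc m) {kms q c (suc m) zero ∷ L} {kms q c (suc m)} λ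
        { zero k → refl
        ; (suc i) zero → kms-suc q c (suc m) (suc i) zero
        ; (suc i) (suc k) → kms-suc q c (suc m) (suc i) (suc k) }
      lower : det R (suc m) (e ∷ L) ≈ D₀
      lower = trans (det-row₀-unit m L) (det-cong m {λ i k → L i (suc k)} {kms q c m} λ i k →
        trans (kms-suc q c (suc m) (suc i) (suc k)) (kms-suc q c m i k))

  det-kms-plus : ∀ q m → det R m (kms q 1# m) ≈ lucas R (1# + 1#) (q * q) (suc m)
  det-kms-plus q = recurrent-unique det-recurrent (λ m → refl) refl det₁
    where
    det-recurrent : Recurrent (1# + 1#) (q * q) (λ m → det R m (kms q 1# m))
    det-recurrent m = trans (det-kms-recurrence q 1# m)
      (solve 3 (λ q X Y → (:2 :- q :* q :* (:1 :- :1)) :* X :- (q :* :1) :* (q :* :1) :* Y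
                          := :2 :* X :- (q :* q) :* Y) refl q _ _)
    det₁ : det R 1 (kms q 1# 1) ≈ lucas R (1# + 1#) (q * q) 2
    det₁ = solve 1 (λ q → :1 :* ((:1 :+ :1 :* :1) :* :1) :+ :0 := :2 :* :1 :- (q :* q) :* :0) refl q

  det-kms-minus : ∀ q m → det R (suc m) (kms q (- 1#) (suc m)) ≈
    pow R (- 1#) m * (pow R q (suc m) * lucas R ((1# + 1#) * q) 1# m)
  det-kms-minus q = recurrent-unique det-recurrent signed-lucas-recurrent det₁ det₂
    where
    a b : Carrier
    a = - ((1# + 1#) * (q * q))
    b = q * q
    f g : ℕ → Carrier
    f m = det R (suc m) (kms q (- 1#) (suc m))
    g m = pow R (- 1#) m * (pow R q (suc m) * lucas R ((1# + 1#) * q) 1# m)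
    det-recurrent : Recurrent a b f
    det-recurrent m = trans (det-kms-recurrence q (- 1#) (suc m))
      (solve 3 (λ q X Y → ((:1 :- :1) :- q :* q :* (:1 :- :- :1)) :* X :- (q :* :- :1) :* (q :* :- :1) :* Y
                          := (:- (:2 :* (q :* q))) :* X :- (q :* q) :* Y) refl q _ _)
    signed-lucas-recurrent : Recurrent a b g
    signed-lucas-recurrent m = solve 5 (λ q s p u v →
      (:- :1 :* (:- :1 :* s)) :* ((q :* (q :* p)) :* ((:2 :* q) :* u :- :1 :* v))
        := (:- (:2 :* (q :* q))) :* ((:- :1 :* s) :* ((q :* p) :* u)) :- (q :* q) :* (s :* (p :* v)))
      refl q _ _ _ _
    det₁ : f 0 ≈ g 0
    det₁ = solve 1 (λ q → :1 :* ((:1 :+ (:- :1) :* :1) :* :1) :+ :0 := :1 :* ((q :* :1) :* :0)) refl q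
    det₂ : f 1 ≈ g 1
    det₂ = trans (det-kms-recurrence q (- 1#) zero)
      (solve 1 (λ q → ((:1 :- :1) :- q :* q :* (:1 :- :- :1))
                        :* (:1 :* ((:1 :+ (:- :1) :* :1) :* :1) :+ :0)
                        :- (q :* :- :1) :* (q :* :- :1) :* :1
                      := (:- :1 :* :1) :* ((q :* (q :* :1)) :* :1)) refl q)

corollary1p10 : ∀ {c ℓ : Level} (R : CommutativeRing c ℓ) →
    let open CommutativeRing R in
    (q : Carrier) (n : ℕ) → 1 ≤ n →
      (det R n (λ j k → pow R q ∣ toℕ j - toℕ k ∣ + δ R j k)
        ≈ lucas R (1# + 1#) (q * q) (suc n))
      ×
      (det R n (λ j k → pow R q ∣ toℕ j - toℕ k ∣ - δ R j k)
        ≈ pow R (- 1#) (n ∸ 1) * (pow R q n * lucas R ((1# + 1#) * q) 1# (n ∸ 1)))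
corollary1p10 R q (suc m) _ =
  trans (det-cong R (suc m) {N = kms R q 1# (suc m)} λ j k → +-congˡ (sym (*-identityˡ (δ R j k))))
        (det-kms-plus R q (suc m)) ,
  trans (det-cong R (suc m) {N = kms R q (- 1#) (suc m)} λ j k → +-congˡ (sym (-1*x≈-x (δ R j k))))
        (det-kms-minus R q m)
  where
  open CommutativeRing R
  open import Algebra.Properties.Ring ring using (-1*x≈-x)
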